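{- For every integer $t\ge 2$, the directed $t$-grid $J_t$ contains strongly connected subgraphs $B_1,\dots,B_t$ which form a bramble of size $t$ and depth (at most) two.
   Context: For $r\ge 2$, the directed $r$-grid $J_r$ is defined as follows. Let $C_1,\dots,C_r$ be directed cycles of length $2r$, with the vertices of $C_i$ labelled $v^i_1,\dots,v^i_{2r}$ in cyclic order. For odd $i\in\{1,\dots,2r\}$ let $P_i$ be the directed path $v^1_i,v^2_i,\dots,v^r_i$, and for even $i$ let $P_i$ be the directed path $v^r_i,v^{r-1}_i,\dots,v^1_i$. Then $J_r=\bigcup_{i=1}^r C_i\cup\bigcup_{i=1}^{2r}P_i$. A bramble in a directed graph $G$ is a set $\mathcal B$ of strongly connected subgraphs (called bags) of $G$ such that for any $B,B'\in\mathcal B$, either $V(B)\cap V(B')\ne\emptyset$ or there are edges $e,e'$ of $G$ with $e$ from $B$ to $B'$ and $e'$ from $B'$ to $B$. Its size is the number of bags. Its depth is the maximum over vertices $v$ of the number of bags containing $v$; "depth two" means no vertex lies in more than two bags. -}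

module Defs where

open import Data.Nat using (ℕ; zero; suc; _+_; _*_; _≤_; _%_)
open import Data.Fin as Fin using (Fin; toℕ)
open import Data.Bool using (Bool; true; false)
open import Data.Product using (Σ; _×_; _,_; ∃)
open import Data.Sum using (_⊎_)
open import Relation.Binary.PropositionalEquality using (_≡_)
open import Function.Definitions using (Injective)

record Subgraph (V : Set) (E : V → V → Set) : Set where
  field
    vert     : V → Bool
    edge     : V → V → Bool
    edge⊆E   : ∀ u v → edge u v ≡ true → E u v
    edge-src : ∀ u v → edge u v ≡ true → vert u ≡ true
    edge-tgt : ∀ u v → edge u v ≡ true → vert v ≡ true
open Subgraph public

data Walk {V : Set} {E : V → V → Set} (H : Subgraph V E) : V → V → Set where
  here : ∀ {u} → Walk H u u
  step : ∀ {u w v} → edge H u w ≡ true → Walk H w v → Walk H u v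

StronglyConnected : {V : Set} {E : V → V → Set} → Subgraph V E → Set
StronglyConnected {V} H =
  (∃ λ (v : V) → vert H v ≡ true) ×
  (∀ u v → vert H u ≡ true → vert H v ≡ true → Walk H u v)

Touch : {V : Set} {E : V → V → Set} → Subgraph V E → Subgraph V E → Set
Touch {V} {E} B B' =
  (∃ λ (v : V) → (vert B v ≡ true) × (vert B' v ≡ true)) ⊎
  ((∃ λ (u : V) → ∃ λ (v : V) → E u v × (vert B u ≡ true) × (vert B' v ≡ true)) ×
   (∃ λ (u : V) → ∃ λ (v : V) → E u v × (vert B' u ≡ true) × (vert B v ≡ true)))

countTrue : ∀ {n} → (Fin n → Bool) → ℕ
countTrue {zero}  f = 0
countTrue {suc n} f with f Fin.zero
... | true  = suc (countTrue (λ i → f (Fin.suc i)))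
... | false = countTrue (λ i → f (Fin.suc i))

-- A family B : Fin k → Subgraph is a bramble of size k: the bags are
-- pairwise distinct (so there are exactly k of them), each bag is
-- strongly connected, and any two bags touch.
IsBramble : {V : Set} {E : V → V → Set} (k : ℕ) → (Fin k → Subgraph V E) → Set
IsBramble {V} {E} k B =
  Injective _≡_ _≡_ B ×
  (∀ i → StronglyConnected (B i)) ×
  (∀ i j → Touch (B i) (B j))

DepthAtMost : {V : Set} {E : V → V → Set} {k : ℕ} → ℕ → (Fin k → Subgraph V E) → Set
DepthAtMost {V} d B = ∀ (v : V) → countTrue (λ i → vert (B i) v) ≤ d

-- The directed r-grid J_r (0-indexed).
-- Vertex (i , j) : Fin r × Fin (2r) stands for v^{i+1}_{j+1}
-- (cycle C_{i+1}, position j+1).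

GridV : ℕ → Set
GridV r = Fin r × Fin (2 * r)

data GridE (r : ℕ) : GridV r → GridV r → Set where
  cyc  : ∀ {i j j'} →
         (suc (toℕ j) ≡ toℕ j' ⊎ (suc (toℕ j) ≡ 2 * r × toℕ j' ≡ 0)) →
         GridE r (i , j) (i , j')
  -- path P_{j+1} with j+1 odd (j even): v^1 → v^2 → … → v^r
  down : ∀ {i i' j} → toℕ j % 2 ≡ 0 → toℕ i' ≡ suc (toℕ i) →
         GridE r (i , j) (i' , j)
  -- path P_{j+1} with j+1 even (j odd): v^r → v^{r-1} → … → v^1
  up   : ∀ {i i' j} → toℕ j % 2 ≡ 1 → toℕ i ≡ suc (toℕ i') →
         GridE r (i , j) (i' , j)

module Submission where

-- Coordinates are 0-indexed: the grid vertex (a , c) is v^{a+1}_{c+1}, so the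
-- rows a < t are the cycles and the columns c < 2t are the paths; even
-- columns run down (a → a+1), odd columns run up.
--
-- For k < t the bag B_k is the subgraph induced by the whole row k together
-- with the parts at or below row k of the columns 2k and 2k+1.
--  * B_k is strongly connected: every vertex reaches the hub (k , 2k) and is
--    reached from it by walks around row k, down column 2k, across the bottom
--    cycle edge from (t-1 , 2k) to (t-1 , 2k+1) and up column 2k+1.
--  * For k ≤ l the bags B_k and B_l share the vertex (l , 2k), so they touch.
--  * A vertex (a , c) lies in B_k only if k = a or k = ⌊c/2⌋: depth ≤ 2.
--  * The hub of B_k lies in no other bag, so the bags are pairwise distinct.

open import Defs
open import Data.Nat using (ℕ; zero; suc; _*_; _≤_; _<_; _≤′_; ≤′-refl; ≤′-step; _%_; pred; ⌊_/2⌋; z≤n; s≤s; NonZero; _≟_; _≤?_)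
open import Data.Nat.Properties using (≤-refl; ≤-trans; ≤-total; <⇒≤; ≤-pred; n≤1+n; *-comm; *-monoˡ-≤; ≤⇒≤′; ≤′⇒≤; 0≢1+n)
open import Data.Nat.DivMod using (_mod_; m<n⇒m%n≡m; [m+kn]%n≡m%n)
open import Data.Fin as Fin using (Fin; toℕ)
open import Data.Fin.Properties using (toℕ-injective; toℕ-fromℕ<; toℕ<n)
open import Data.Bool using (Bool; true; false)
open import Data.Product using (Σ; _×_; _,_; proj₁; proj₂) renaming (swap to swap×)
open import Data.Sum as Sum using (_⊎_; inj₁; inj₂; swap)
open import Relation.Nullary using (Dec; yes; no; does; _×-dec_; _⊎-dec_; contradiction)
open import Relation.Nullary.Decidable using (dec-true; map′)
open import Relation.Binary.PropositionalEquality using (_≡_; _≢_; refl; sym; trans; cong; subst; subst₂; cong₂)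

does-sound : ∀ {P : Set} (P? : Dec P) → does P? ≡ true → P
does-sound (yes p) _ = p
does-sound (no _) ()

module _ {V : Set} {E : V → V → Set} (E? : ∀ u v → Dec (E u v))
         {P : V → Set} (P? : ∀ v → Dec (P v)) where

  private
    InducedEdge? : ∀ u v → Dec (E u v × P u × P v)
    InducedEdge? u v = E? u v ×-dec P? u ×-dec P? v

  induced : Subgraph V E
  induced = record
    { vert     = λ v → does (P? v)
    ; edge     = λ u v → does (InducedEdge? u v)
    ; edge⊆E   = λ u v e → proj₁ (does-sound (InducedEdge? u v) e)
    ; edge-src = λ u v e → dec-true (P? u) (proj₁ (proj₂ (does-sound (InducedEdge? u v) e)))
    ; edge-tgt = λ u v e → dec-true (P? v) (proj₂ (proj₂ (does-sound (InducedEdge? u v) e)))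
    }

  induced-vert : ∀ {v} → P v → vert induced v ≡ true
  induced-vert = dec-true (P? _)

  induced-vert⁻¹ : ∀ {v} → vert induced v ≡ true → P v
  induced-vert⁻¹ = does-sound (P? _)

  induced-edge : ∀ {u v} → E u v → P u → P v → edge induced u v ≡ true
  induced-edge e pu pv = dec-true (InducedEdge? _ _) (e , pu , pv)

_++ʷ_ : ∀ {V : Set} {E : V → V → Set} {H : Subgraph V E} {u v w} →
        Walk H u v → Walk H v w → Walk H u w
here     ++ʷ q = q
step e p ++ʷ q = step e (p ++ʷ q)

infixr 5 _++ʷ_

module Chain {V : Set} {E : V → V → Set} (H : Subgraph V E) (f : ℕ → V) (lo hi : ℕ) where

  ascend : (∀ {m} → lo ≤ m → suc m ≤ hi → edge H (f m) (f (suc m)) ≡ true) →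
           ∀ {a b} → lo ≤ a → a ≤ b → b ≤ hi → Walk H (f a) (f b)
  ascend e {a} lo≤a a≤b = go (≤⇒≤′ a≤b)
    where
      go : ∀ {b} → a ≤′ b → b ≤ hi → Walk H (f a) (f b)
      go ≤′-refl          _     = here
      go (≤′-step a≤′b) b<hi =
        go a≤′b (<⇒≤ b<hi) ++ʷ step (e (≤-trans lo≤a (≤′⇒≤ a≤′b)) b<hi) here

  descend : (∀ {m} → lo ≤ m → suc m ≤ hi → edge H (f (suc m)) (f m) ≡ true) →
            ∀ {a b} → lo ≤ a → a ≤ b → b ≤ hi → Walk H (f b) (f a)
  descend e {a} lo≤a a≤b = go (≤⇒≤′ a≤b)
    where
      go : ∀ {b} → a ≤′ b → b ≤ hi → Walk H (f b) (f a)
      go ≤′-refl          _     = here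
      go (≤′-step a≤′b) b<hi =
        step (e (≤-trans lo≤a (≤′⇒≤ a≤′b)) b<hi) (go a≤′b (<⇒≤ b<hi))

countTrue-none : ∀ {n} (f : Fin n → Bool) → (∀ l → f l ≢ true) → countTrue f ≡ 0
countTrue-none {zero}  f never = refl
countTrue-none {suc n} f never with f Fin.zero in eq
... | true  = contradiction eq (never Fin.zero)
... | false = countTrue-none (λ l → f (Fin.suc l)) (λ l → never (Fin.suc l))

countTrue-≤1 : ∀ {n} (f : Fin n → Bool) a → (∀ l → f l ≡ true → toℕ l ≡ a) → countTrue f ≤ 1
countTrue-≤1 {zero}  f a only = z≤n
countTrue-≤1 {suc n} f a only with f Fin.zero in eq
... | true  rewrite countTrue-none (λ l → f (Fin.suc l))
                    (λ l e → 0≢1+n (trans (only Fin.zero eq) (sym (only (Fin.suc l) e))))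
            = ≤-refl
... | false = countTrue-≤1 (λ l → f (Fin.suc l)) (pred a) (λ l e → cong pred (only (Fin.suc l) e))

-- If the first allowed position is 0, a later position suc x is the second.
later-is-second : ∀ {x y z} → 0 ≡ y → suc x ≡ y ⊎ suc x ≡ z → x ≡ pred z
later-is-second refl (inj₂ e) = cong pred e

countTrue-≤2 : ∀ {n} (f : Fin n → Bool) a b →
               (∀ l → f l ≡ true → toℕ l ≡ a ⊎ toℕ l ≡ b) → countTrue f ≤ 2
countTrue-≤2 {zero}  f a b only = z≤n
countTrue-≤2 {suc n} f a b only with f Fin.zero in eq
... | false = countTrue-≤2 (λ l → f (Fin.suc l)) (pred a) (pred b)
                (λ l e → Sum.map (cong pred) (cong pred) (only (Fin.suc l) e))
... | true with only Fin.zero eq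
...   | inj₁ 0≡a = s≤s (countTrue-≤1 (λ l → f (Fin.suc l)) (pred b)
                       (λ l e → later-is-second 0≡a (only (Fin.suc l) e)))
...   | inj₂ 0≡b = s≤s (countTrue-≤1 (λ l → f (Fin.suc l)) (pred a)
                       (λ l e → later-is-second 0≡b (swap (only (Fin.suc l) e))))

-- GridE spelled out as a decidable proposition, so that the grid's edge
-- relation is decidable and induced subgraphs of J_r can be formed.
GridStep : (r : ℕ) → GridV r → GridV r → Set
GridStep r (i , j) (i' , j') =
  (i ≡ i' × (suc (toℕ j) ≡ toℕ j' ⊎ (suc (toℕ j) ≡ 2 * r × toℕ j' ≡ 0))) ⊎
  (j ≡ j' × toℕ j % 2 ≡ 0 × toℕ i' ≡ suc (toℕ i)) ⊎
  (j ≡ j' × toℕ j % 2 ≡ 1 × toℕ i ≡ suc (toℕ i'))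

GridStep? : ∀ r u v → Dec (GridStep r u v)
GridStep? r (i , j) (i' , j') =
  ((i Fin.≟ i') ×-dec ((suc (toℕ j) ≟ toℕ j') ⊎-dec ((suc (toℕ j) ≟ 2 * r) ×-dec (toℕ j' ≟ 0)))) ⊎-dec
  ((j Fin.≟ j') ×-dec ((toℕ j % 2 ≟ 0) ×-dec (toℕ i' ≟ suc (toℕ i)))) ⊎-dec
  ((j Fin.≟ j') ×-dec ((toℕ j % 2 ≟ 1) ×-dec (toℕ i ≟ suc (toℕ i'))))

GridE? : ∀ r u v → Dec (GridE r u v)
GridE? r u v = map′ (fromStep u v) toStep (GridStep? r u v)
  where
    fromStep : ∀ u v → GridStep r u v → GridE r u v
    fromStep _ _ (inj₁ (refl , p))                = cyc p
    fromStep _ _ (inj₂ (inj₁ (refl , even , s))) = down even s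
    fromStep _ _ (inj₂ (inj₂ (refl , odd , s)))  = up odd s

    toStep : GridE r u v → GridStep r u v
    toStep (cyc p)         = inj₁ (refl , p)
    toStep (down even s)   = inj₂ (inj₁ (refl , even , s))
    toStep (up odd s)      = inj₂ (inj₂ (refl , odd , s))

toℕ-mod : ∀ {a m} .{{_ : NonZero m}} → a < m → toℕ (a mod m) ≡ a
toℕ-mod a<m = trans (toℕ-fromℕ< _) (m<n⇒m%n≡m a<m)

-- the bags containing columns 2k and 2k+1 are recovered by halving
⌊2k/2⌋≡k : ∀ k → ⌊ k * 2 /2⌋ ≡ k
⌊2k/2⌋≡k zero    = refl
⌊2k/2⌋≡k (suc k) = cong suc (⌊2k/2⌋≡k k)

⌊2k+1/2⌋≡k : ∀ k → ⌊ suc (k * 2) /2⌋ ≡ k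
⌊2k+1/2⌋≡k zero    = refl
⌊2k+1/2⌋≡k (suc k) = cong suc (⌊2k+1/2⌋≡k k)

InBag : ℕ → ℕ → ℕ → Set
InBag k a c = a ≡ k ⊎ (c ≡ k * 2 ⊎ c ≡ suc (k * 2)) × k ≤ a

InBag? : ∀ k a c → Dec (InBag k a c)
InBag? k a c = (a ≟ k) ⊎-dec (((c ≟ k * 2) ⊎-dec (c ≟ suc (k * 2))) ×-dec (k ≤? a))

InBag-index : ∀ {k a c} → InBag k a c → k ≡ a ⊎ k ≡ ⌊ c /2⌋
InBag-index     (inj₁ refl)               = inj₁ refl
InBag-index {k} (inj₂ (inj₁ refl , _)) = inj₂ (sym (⌊2k/2⌋≡k k))
InBag-index {k} (inj₂ (inj₂ refl , _)) = inj₂ (sym (⌊2k+1/2⌋≡k k))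

module Bags (n : ℕ) where

  t : ℕ
  t = suc n

  T : ℕ
  T = 2 * t

  pt : ℕ → ℕ → GridV t
  pt a c = a mod t , c mod T

  pt-toℕ : ∀ (u : GridV t) → pt (toℕ (proj₁ u)) (toℕ (proj₂ u)) ≡ u
  pt-toℕ (i , j) = cong₂ _,_ (toℕ-injective (toℕ-mod (toℕ<n i))) (toℕ-injective (toℕ-mod (toℕ<n j)))

  column-bound : ∀ {k} → k < t → suc (k * 2) < T
  column-bound {k} k<t = subst (suc (suc (k * 2)) ≤_) (*-comm t 2) (*-monoˡ-≤ 2 k<t)

  row-edge : ∀ {a c} → suc c < T → GridE t (pt a c) (pt a (suc c))
  row-edge c+1<T = cyc (inj₁ (trans (cong suc (toℕ-mod (<⇒≤ c+1<T))) (sym (toℕ-mod c+1<T))))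

  wrap-edge : ∀ {a} → GridE t (pt a (pred T)) (pt a 0)
  wrap-edge = cyc (inj₂ (cong suc (toℕ-mod ≤-refl) , refl))

  down-edge : ∀ {a c} → suc a < t → c < T → c % 2 ≡ 0 → GridE t (pt a c) (pt (suc a) c)
  down-edge a+1<t c<T even =
    down (trans (cong (_% 2) (toℕ-mod c<T)) even)
         (trans (toℕ-mod a+1<t) (cong suc (sym (toℕ-mod (<⇒≤ a+1<t)))))

  up-edge : ∀ {a c} → suc a < t → c < T → c % 2 ≡ 1 → GridE t (pt (suc a) c) (pt a c)
  up-edge a+1<t c<T odd =
    up (trans (cong (_% 2) (toℕ-mod c<T)) odd)
       (trans (toℕ-mod a+1<t) (cong suc (sym (toℕ-mod (<⇒≤ a+1<t)))))

  Member : ℕ → GridV t → Set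
  Member k u = InBag k (toℕ (proj₁ u)) (toℕ (proj₂ u))

  Member? : ∀ k u → Dec (Member k u)
  Member? k u = InBag? k (toℕ (proj₁ u)) (toℕ (proj₂ u))

  bag : ℕ → Subgraph (GridV t) (GridE t)
  bag k = induced (GridE? t) (Member? k)

  pt-member : ∀ {k a c} → a < t → c < T → InBag k a c → Member k (pt a c)
  pt-member {k} a<t c<T = subst₂ (InBag k) (sym (toℕ-mod a<t)) (sym (toℕ-mod c<T))

  pt∈bag : ∀ {k a c} → a < t → c < T → InBag k a c → vert (bag k) (pt a c) ≡ true
  pt∈bag a<t c<T m = induced-vert (GridE? t) (Member? _) (pt-member a<t c<T m)

  pt∈bag⁻¹ : ∀ {k a c} → a < t → c < T → vert (bag k) (pt a c) ≡ true → InBag k a c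
  pt∈bag⁻¹ {k} a<t c<T p =
    subst₂ (InBag k) (toℕ-mod a<t) (toℕ-mod c<T) (induced-vert⁻¹ (GridE? t) (Member? k) p)

  bag-edge : ∀ {k a c a' c'} → a < t → c < T → a' < t → c' < T →
             GridE t (pt a c) (pt a' c') → InBag k a c → InBag k a' c' →
             edge (bag k) (pt a c) (pt a' c') ≡ true
  bag-edge a<t c<T a'<t c'<T e m m' =
    induced-edge (GridE? t) (Member? _) e (pt-member a<t c<T m) (pt-member a'<t c'<T m')

  module StrongConnectivity (k : ℕ) (k<t : k < t) where

    H : Subgraph (GridV t) (GridE t)
    H = bag k

    k≤n : k ≤ n
    k≤n = ≤-pred k<t

    left right : ℕ
    left  = k * 2
    right = suc (k * 2)

    right<T : right < T
    right<T = column-bound k<t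

    left<T : left < T
    left<T = <⇒≤ right<T

    -- the hub of B_k, through which all walks are routed
    hub : GridV t
    hub = pt k left

    hub∈H : vert H hub ≡ true
    hub∈H = pt∈bag k<t left<T (inj₁ refl)

    row-walk : ∀ {c c'} → c < T → c' < T → Walk H (pt k c) (pt k c')
    row-walk c<T c'<T =
      Chain.ascend H (pt k) 0 (pred T) row-step z≤n (≤-pred c<T) ≤-refl ++ʷ
      step (bag-edge k<t ≤-refl k<t (s≤s z≤n) (wrap-edge {k}) (inj₁ refl) (inj₁ refl))
           (Chain.ascend H (pt k) 0 (pred T) row-step z≤n z≤n (≤-pred c'<T))
      where
        row-step : ∀ {m} → 0 ≤ m → suc m ≤ pred T → edge H (pt k m) (pt k (suc m)) ≡ true
        row-step _ m+1<T-1 = bag-edge k<t (<⇒≤ (s≤s m+1<T-1)) k<t (s≤s m+1<T-1)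
                               (row-edge {k} (s≤s m+1<T-1)) (inj₁ refl) (inj₁ refl)

    down-walk : ∀ {a b} → k ≤ a → a ≤ b → b < t → Walk H (pt a left) (pt b left)
    down-walk k≤a a≤b b<t = Chain.ascend H (λ a → pt a left) k n down-step k≤a a≤b (≤-pred b<t)
      where
        down-step : ∀ {m} → k ≤ m → suc m ≤ n → edge H (pt m left) (pt (suc m) left) ≡ true
        down-step {m} k≤m m<n =
          bag-edge (s≤s (<⇒≤ m<n)) left<T (s≤s m<n) left<T
            (down-edge (s≤s m<n) left<T ([m+kn]%n≡m%n 0 k 2))
            (inj₂ (inj₁ refl , k≤m)) (inj₂ (inj₁ refl , ≤-trans k≤m (n≤1+n m)))

    up-walk : ∀ {a b} → k ≤ a → a ≤ b → b < t → Walk H (pt b right) (pt a right)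
    up-walk k≤a a≤b b<t = Chain.descend H (λ a → pt a right) k n up-step k≤a a≤b (≤-pred b<t)
      where
        up-step : ∀ {m} → k ≤ m → suc m ≤ n → edge H (pt (suc m) right) (pt m right) ≡ true
        up-step {m} k≤m m<n =
          bag-edge (s≤s m<n) right<T (s≤s (<⇒≤ m<n)) right<T
            (up-edge (s≤s m<n) right<T ([m+kn]%n≡m%n 1 k 2))
            (inj₂ (inj₂ refl , ≤-trans k≤m (n≤1+n m))) (inj₂ (inj₂ refl , k≤m))

    around : ∀ {a b} → k ≤ a → a < t → k ≤ b → b < t → Walk H (pt a left) (pt b right)
    around k≤a a<t k≤b b<t =
      down-walk k≤a (≤-pred a<t) ≤-refl ++ʷ
      step (bag-edge ≤-refl left<T ≤-refl right<T (row-edge {n} right<T)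
                     (inj₂ (inj₁ refl , k≤n)) (inj₂ (inj₂ refl , k≤n)))
           (up-walk k≤b (≤-pred b<t) ≤-refl)

    to-hub : ∀ {a c} → a < t → c < T → InBag k a c → Walk H (pt a c) hub
    to-hub a<t c<T (inj₁ refl)             = row-walk c<T left<T
    to-hub a<t c<T (inj₂ (inj₁ refl , k≤a)) = around k≤a a<t ≤-refl k<t ++ʷ row-walk right<T left<T
    to-hub a<t c<T (inj₂ (inj₂ refl , k≤a)) = up-walk ≤-refl k≤a a<t ++ʷ row-walk right<T left<T

    from-hub : ∀ {a c} → a < t → c < T → InBag k a c → Walk H hub (pt a c)
    from-hub a<t c<T (inj₁ refl)             = row-walk left<T c<T
    from-hub a<t c<T (inj₂ (inj₁ refl , k≤a)) = down-walk ≤-refl k≤a a<t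
    from-hub a<t c<T (inj₂ (inj₂ refl , k≤a)) = around ≤-refl k<t k≤a a<t

    strongly-connected : StronglyConnected H
    strongly-connected = (hub , hub∈H) , reach
      where
        reach : ∀ u v → vert H u ≡ true → vert H v ≡ true → Walk H u v
        reach u@(i , j) v@(i' , j') u∈H v∈H =
          subst₂ (Walk H) (pt-toℕ u) (pt-toℕ v)
            (to-hub (toℕ<n i) (toℕ<n j) (induced-vert⁻¹ (GridE? t) (Member? k) u∈H) ++ʷ
             from-hub (toℕ<n i') (toℕ<n j') (induced-vert⁻¹ (GridE? t) (Member? k) v∈H))

  bags : Fin t → Subgraph (GridV t) (GridE t)
  bags l = bag (toℕ l)

  bags-strongly-connected : ∀ l → StronglyConnected (bags l)
  bags-strongly-connected l = StrongConnectivity.strongly-connected (toℕ l) (toℕ<n l)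

  shared-vertex : ∀ {k l} → k ≤ l → k < t → l < t →
                  vert (bag k) (pt l (k * 2)) ≡ true × vert (bag l) (pt l (k * 2)) ≡ true
  shared-vertex k≤l k<t l<t =
    pt∈bag l<t 2k<T (inj₂ (inj₁ refl , k≤l)) , pt∈bag l<t 2k<T (inj₁ refl)
    where 2k<T = <⇒≤ (column-bound k<t)

  bags-touch : ∀ k l → Touch (bags k) (bags l)
  bags-touch k l with ≤-total (toℕ k) (toℕ l)
  ... | inj₁ k≤l = inj₁ (pt (toℕ l) (toℕ k * 2) , shared-vertex k≤l (toℕ<n k) (toℕ<n l))
  ... | inj₂ l≤k = inj₁ (pt (toℕ k) (toℕ l * 2) , swap× (shared-vertex l≤k (toℕ<n l) (toℕ<n k)))

  -- The hub (k , 2k) of B_k lies in B_l only if l = k.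
  bags-injective : ∀ {k l} → bags k ≡ bags l → k ≡ l
  bags-injective {k} {l} B_k≡B_l = toℕ-injective (sym (same-index (InBag-index hub∈B_l)))
    where
      open StrongConnectivity (toℕ k) (toℕ<n k) using (hub; hub∈H; left<T)
      hub∈B_l : InBag (toℕ l) (toℕ k) (toℕ k * 2)
      hub∈B_l = pt∈bag⁻¹ (toℕ<n k) left<T (trans (cong (λ B → vert B hub) (sym B_k≡B_l)) hub∈H)
      same-index : toℕ l ≡ toℕ k ⊎ toℕ l ≡ ⌊ toℕ k * 2 /2⌋ → toℕ l ≡ toℕ k
      same-index (inj₁ e) = e
      same-index (inj₂ e) = trans e (⌊2k/2⌋≡k (toℕ k))

  -- A vertex (a , c) lies only in B_a and B_⌊c/2⌋.
  bags-depth : DepthAtMost 2 bags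
  bags-depth (i , j) = countTrue-≤2 (λ l → vert (bags l) (i , j)) (toℕ i) ⌊ toℕ j /2⌋
    (λ l u∈B_l → InBag-index (induced-vert⁻¹ (GridE? t) (Member? (toℕ l)) u∈B_l))

-- Lemma 3.4: the directed t-grid J_t has a bramble of size t and depth 2.
-- (The construction works for every t ≥ 1; the hypothesis excludes t = 0.)

lemma3p4 : (t : ℕ) → 2 ≤ t →
    Σ (Fin t → Subgraph (GridV t) (GridE t)) λ B →
      IsBramble t B × DepthAtMost 2 B
lemma3p4 (suc n) _ =
  bags , (bags-injective , bags-strongly-connected , bags-touch) , bags-depth
  where open Bags n
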